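{- Let $G$ be a finite simple graph with vertex set $[n]$ and let $\sigma$ be a permutation of $[n]$. Then there is exactly one bicoloring $c$ of $G$ for which $\sigma(1),\sigma(2),\dots,\sigma(n)$ is a successful pressing sequence of $(G,c)$.
   Context: A bicoloring of $G$ is a map $c:V(G)\to\{\text{black},\text{white}\}$. Pressing a black vertex $v$ complements the induced subgraph on the closed neighborhood $N^\ast(v)=N(v)\cup\{v\}$ and flips the color of each vertex of $N^\ast(v)$, leaving everything else unchanged. A pressing sequence is a sequence of vertices each of which is black at the moment it is pressed (after pressing the preceding ones in order); it is successful if the final graph has no edges and all vertices white. -}

module Defs where

open import Data.Nat using (ℕ)
open import Data.Fin using (Fin; _≟_)
open import Data.Bool using (Bool; true; false; not; _∧_; _∨_; _xor_; if_then_else_)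
open import Data.List using (List; []; _∷_; map; allFin)
open import Data.Product using (_×_; _,_)
open import Data.Unit using (⊤)
open import Relation.Binary.PropositionalEquality using (_≡_)
open import Relation.Nullary.Decidable using (⌊_⌋)
open import Data.Fin.Permutation using (Permutation′; _⟨$⟩ʳ_)

Graph : ℕ → Set
Graph n = Fin n → Fin n → Bool

IsSimple : ∀ {n} → Graph n → Set
IsSimple {n} G = ((v : Fin n) → G v v ≡ false) × ((u w : Fin n) → G u w ≡ G w u)

-- Bicoloring: true = black, false = white.
Coloring : ℕ → Set
Coloring n = Fin n → Bool

inClosedNbhd : ∀ {n} → Graph n → Fin n → Fin n → Bool
inClosedNbhd G v u = ⌊ u ≟ v ⌋ ∨ G v u

-- Pressing v: complement the induced subgraph on N*(v) (pairs of distinct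
-- vertices both in N*(v) get their adjacency toggled; no loops are created)
-- and flip the colour of every vertex of N*(v).
pressGraph : ∀ {n} → Graph n → Fin n → Graph n
pressGraph G v x y =
  G x y xor (inClosedNbhd G v x ∧ inClosedNbhd G v y ∧ not ⌊ x ≟ y ⌋)

pressColor : ∀ {n} → Graph n → Coloring n → Fin n → Coloring n
pressColor G c v x = c x xor inClosedNbhd G v x

SuccessfulPressing : ∀ {n} → Graph n → Coloring n → List (Fin n) → Set
SuccessfulPressing {n} G c [] =
  ((x y : Fin n) → G x y ≡ false) × ((x : Fin n) → c x ≡ false)
SuccessfulPressing G c (v ∷ vs) =
  (c v ≡ true) × SuccessfulPressing (pressGraph G v) (pressColor G c v) vs

permSeq : ∀ {n} → Permutation′ n → List (Fin n)
permSeq {n} σ = map (σ ⟨$⟩ʳ_) (allFin n)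

module Submission where

-- The evolution of the graph under a pressing sequence does not
-- depend on the colouring, and pressing v flips exactly the colours of the
-- closed neighbourhood N*(v) in the current graph.  Reading a sequence vs
-- backwards therefore determines a single candidate colouring,
-- forcedColoring G vs, namely the sum (xor) of the closed neighbourhoods of
-- the pressed vertices in the successive graphs.
--   * Uniqueness holds for every graph and every list: a colouring for which
--     vs is successful coincides with forcedColoring G vs.
--   * Existence: in a simple graph, pressing v leaves v isolated, and an
--     isolated vertex other than v stays isolated and keeps its colour.
--     Hence if vs has no repetitions and every vertex outside vs is isolated,
--     forcedColoring G vs makes vs successful; in particular each pressed
--     vertex is black when pressed, since afterwards it is isolated, never
--     pressed again, and must end white.
-- The theorem follows because σ(1), …, σ(n) lists every vertex exactly once.

open import Defs
open import Data.Nat using (ℕ)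
open import Data.Fin using (Fin; _≟_)
open import Data.Fin.Permutation using (Permutation′; _⟨$⟩ʳ_; _⟨$⟩ˡ_; inverseˡ; inverseʳ)
open import Data.Bool using (Bool; true; false; not; _∧_; _xor_)
open import Data.Bool.Properties using (xor-assoc; xor-same; xor-identityʳ; ∧-zeroʳ; ∧-identityʳ; ∧-commutativeMonoid)
open import Algebra.Bundles using (CommutativeMonoid)
open import Algebra.Properties.CommutativeSemigroup
  (CommutativeMonoid.commutativeSemigroup ∧-commutativeMonoid) using (x∙yz≈y∙xz)
open import Data.List using (List; []; _∷_)
open import Data.List.Membership.Propositional using (_∈_; _∉_)
open import Data.List.Membership.Propositional.Properties using (∈-map⁺; ∈-allFin)
open import Data.List.Relation.Unary.Any using (here; there)
open import Data.List.Relation.Unary.All using (lookup)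
open import Data.List.Relation.Unary.AllPairs using (_∷_)
open import Data.List.Relation.Unary.Unique.Propositional using (Unique)
import Data.List.Relation.Unary.Unique.Propositional.Properties as Unique
open import Data.Product using (Σ; _×_; _,_)
open import Relation.Binary.PropositionalEquality
  using (_≡_; _≢_; _≗_; refl; sym; trans; cong; cong₂; subst; module ≡-Reasoning)
open import Relation.Nullary using (Dec; ¬_; yes; no; contradiction)
open import Relation.Nullary.Decidable using (⌊_⌋; isYes≗does; dec-true; dec-false)

xor-cancelʳ : (a b : Bool) → (a xor b) xor b ≡ a
xor-cancelʳ a b = begin
  (a xor b) xor b  ≡⟨ xor-assoc a b b ⟩
  a xor (b xor b)  ≡⟨ cong (a xor_) (xor-same b) ⟩
  a xor false      ≡⟨ xor-identityʳ a ⟩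
  a                ∎
  where open ≡-Reasoning

⌊⌋-true : {A : Set} (a? : Dec A) → A → ⌊ a? ⌋ ≡ true
⌊⌋-true a? a = trans (isYes≗does a?) (dec-true a? a)

⌊⌋-false : {A : Set} (a? : Dec A) → ¬ A → ⌊ a? ⌋ ≡ false
⌊⌋-false a? ¬a = trans (isYes≗does a?) (dec-false a? ¬a)

module _ {n : ℕ} where

  Symmetric : Graph n → Set
  Symmetric G = (u w : Fin n) → G u w ≡ G w u

  Loopless : Graph n → Set
  Loopless G = (v : Fin n) → G v v ≡ false

  Isolated : Graph n → Fin n → Set
  Isolated G x = (y : Fin n) → G x y ≡ false

  -- The only colouring that can make vs successful: the final colouring is
  -- all white, and each press adds N*(v) (in the current graph) to it.
  forcedColoring : Graph n → List (Fin n) → Coloring n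
  forcedColoring G []       x = false
  forcedColoring G (v ∷ vs) x = forcedColoring (pressGraph G v) vs x xor inClosedNbhd G v x

  successful-resp-≗ : (G : Graph n) {c c′ : Coloring n} (vs : List (Fin n)) →
                      c ≗ c′ → SuccessfulPressing G c vs → SuccessfulPressing G c′ vs
  successful-resp-≗ G []       c≗c′ (edgeless , white) = edgeless , λ x → trans (sym (c≗c′ x)) (white x)
  successful-resp-≗ G (v ∷ vs) c≗c′ (black , rest) =
    trans (sym (c≗c′ v)) black ,
    successful-resp-≗ (pressGraph G v) vs (λ x → cong (_xor inClosedNbhd G v x) (c≗c′ x)) rest

  successful⇒forced : (G : Graph n) (c : Coloring n) (vs : List (Fin n)) →
                      SuccessfulPressing G c vs → c ≗ forcedColoring G vs
  successful⇒forced G c []       (_ , white) x = white x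
  successful⇒forced G c (v ∷ vs) (_ , rest)  x = begin
    c x                                                          ≡⟨ sym (xor-cancelʳ (c x) (inClosedNbhd G v x)) ⟩
    pressColor G c v x xor inClosedNbhd G v x                    ≡⟨ cong (_xor inClosedNbhd G v x)
                                                                      (successful⇒forced (pressGraph G v) _ vs rest x) ⟩
    forcedColoring (pressGraph G v) vs x xor inClosedNbhd G v x  ∎
    where open ≡-Reasoning

  -- Pressing preserves symmetry: the set of toggled pairs is symmetric.
  press-symmetric : (G : Graph n) (v : Fin n) → Symmetric G → Symmetric (pressGraph G v)
  press-symmetric G v sym-G x y = cong₂ _xor_ (sym-G x y) (begin
    N x ∧ (N y ∧ not ⌊ x ≟ y ⌋)  ≡⟨ x∙yz≈y∙xz (N x) (N y) _ ⟩
    N y ∧ (N x ∧ not ⌊ x ≟ y ⌋)  ≡⟨ cong (λ b → N y ∧ (N x ∧ not b)) (≟-swap x y) ⟩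
    N y ∧ (N x ∧ not ⌊ y ≟ x ⌋)  ∎)
    where
    open ≡-Reasoning
    N : Fin n → Bool
    N = inClosedNbhd G v
    ≟-swap : (x y : Fin n) → ⌊ x ≟ y ⌋ ≡ ⌊ y ≟ x ⌋
    ≟-swap x y with x ≟ y
    ... | yes x≡y = sym (⌊⌋-true (y ≟ x) (sym x≡y))
    ... | no  x≢y = sym (⌊⌋-false (y ≟ x) (λ y≡x → x≢y (sym y≡x)))

  -- Loops are never created, since the toggled pairs are distinct.
  press-loopless : (G : Graph n) (v : Fin n) → Loopless G → Loopless (pressGraph G v)
  press-loopless G v loopless x
    rewrite ⌊⌋-true (x ≟ x) refl | ∧-zeroʳ (inClosedNbhd G v x) | ∧-zeroʳ (inClosedNbhd G v x)
    = trans (xor-identityʳ (G x x)) (loopless x)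

  -- The pressed vertex becomes isolated: for y ≠ v the edge vy is toggled
  -- exactly when it is present.
  pressed-isolated : (G : Graph n) (v : Fin n) → Loopless G → Isolated (pressGraph G v) v
  pressed-isolated G v loopless y with y ≟ v
  ... | yes refl rewrite ⌊⌋-true (y ≟ y) refl | loopless y = refl
  ... | no  y≢v rewrite ⌊⌋-true (v ≟ v) refl | ⌊⌋-false (v ≟ y) (λ v≡y → y≢v (sym v≡y))
                      | ∧-identityʳ (G v y) = xor-same (G v y)

  isolated-outside : (G : Graph n) (v x : Fin n) → Symmetric G → Isolated G x → x ≢ v →
                     inClosedNbhd G v x ≡ false
  isolated-outside G v x sym-G iso x≢v rewrite ⌊⌋-false (x ≟ v) x≢v | sym-G v x = iso v

  isolated-stays : (G : Graph n) (v x : Fin n) → Symmetric G → Isolated G x → x ≢ v →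
                   Isolated (pressGraph G v) x
  isolated-stays G v x sym-G iso x≢v y rewrite isolated-outside G v x sym-G iso x≢v | iso y = refl

  forced-isolated : (G : Graph n) (vs : List (Fin n)) (x : Fin n) → Symmetric G → Isolated G x →
                    x ∉ vs → forcedColoring G vs x ≡ false
  forced-isolated G []       x sym-G iso x∉ = refl
  forced-isolated G (v ∷ vs) x sym-G iso x∉
    rewrite isolated-outside G v x sym-G iso (λ x≡v → x∉ (here x≡v))
          | forced-isolated (pressGraph G v) vs x (press-symmetric G v sym-G)
              (isolated-stays G v x sym-G iso (λ x≡v → x∉ (here x≡v))) (λ x∈ → x∉ (there x∈))
    = refl

  forced-successful : (G : Graph n) (vs : List (Fin n)) → Symmetric G → Loopless G → Unique vs →
                      ((x : Fin n) → x ∉ vs → Isolated G x) →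
                      SuccessfulPressing G (forcedColoring G vs) vs
  forced-successful G []       sym-G loopless _ outside-isolated =
    (λ x y → outside-isolated x (λ ()) y) , (λ _ → refl)
  forced-successful G (v ∷ vs) sym-G loopless (v∉vs ∷ unique) outside-isolated =
    black ,
    successful-resp-≗ G′ vs (λ x → sym (xor-cancelʳ (forcedColoring G′ vs x) (inClosedNbhd G v x)))
      (forced-successful G′ vs (press-symmetric G v sym-G) (press-loopless G v loopless) unique outside-isolated′)
    where
    G′ : Graph n
    G′ = pressGraph G v

    -- The invariant for the recursive call: after pressing v, every vertex
    -- outside vs (now including v itself) is isolated.
    outside-isolated′ : (x : Fin n) → x ∉ vs → Isolated G′ x
    outside-isolated′ x x∉vs = by-cases (x ≟ v)
      where
      by-cases : Dec (x ≡ v) → Isolated G′ x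
      by-cases (yes refl) = pressed-isolated G v loopless
      by-cases (no  x≢v)  = isolated-stays G v x sym-G
        (outside-isolated x λ { (here x≡v) → x≢v x≡v ; (there x∈vs) → x∉vs x∈vs }) x≢v

    -- v is white at the end and unaffected by later presses, so it starts black.
    black : forcedColoring G (v ∷ vs) v ≡ true
    black rewrite forced-isolated G′ vs v (press-symmetric G v sym-G) (pressed-isolated G v loopless)
                    (λ v∈vs → lookup v∉vs v∈vs refl)
                | ⌊⌋-true (v ≟ v) refl = refl

  permSeq-unique : (σ : Permutation′ n) → Unique (permSeq σ)
  permSeq-unique σ = Unique.map⁺ σ-injective (Unique.allFin⁺ n)
    where
    σ-injective : {x y : Fin n} → σ ⟨$⟩ʳ x ≡ σ ⟨$⟩ʳ y → x ≡ y
    σ-injective σx≡σy = trans (sym (inverseˡ σ)) (trans (cong (σ ⟨$⟩ˡ_) σx≡σy) (inverseˡ σ))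

  permSeq-complete : (σ : Permutation′ n) (x : Fin n) → x ∈ permSeq σ
  permSeq-complete σ x = subst (_∈ permSeq σ) (inverseʳ σ) (∈-map⁺ (σ ⟨$⟩ʳ_) (∈-allFin (σ ⟨$⟩ˡ x)))

proposition4 : (n : ℕ) (G : Graph n) → IsSimple G → (σ : Permutation′ n) →
    Σ (Coloring n) (λ c → SuccessfulPressing G c (permSeq σ)
    × ((c′ : Coloring n) → SuccessfulPressing G c′ (permSeq σ) → (v : Fin n) → c′ v ≡ c v))
proposition4 n G (loopless , sym-G) σ =
  forcedColoring G (permSeq σ) ,
  forced-successful G (permSeq σ) sym-G loopless (permSeq-unique σ)
    (λ x x∉ → contradiction (permSeq-complete σ x) x∉) ,
  (λ c′ successful → successful⇒forced G c′ (permSeq σ) successful)
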